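{- Let $p \ge 5$ and $p+3 \le q \le 3 + \binom{p}{\lfloor \frac{p}{2} \rfloor}$. Then $f(K(3,p,q)) = 2$.
   Context: $K(3,p,q)$ is the complete tripartite graph with parts of sizes $3$, $p$, $q$. A strong orientation of a graph is an orientation of all edges making the digraph strongly connected; the diameter of a strongly connected digraph is the maximum directed distance between ordered pairs of vertices. The oriented diameter $f(G)$ is the minimum diameter over all strong orientations of $G$. -}

module Defs where

open import Data.Nat using (ℕ; zero; suc; _≤_; _<_)
open import Data.Fin using (Fin)
open import Data.Sum using (_⊎_; inj₁; inj₂)
open import Data.Product using (_×_; ∃; ∃-syntax; Σ-syntax)
open import Data.Empty using (⊥)
open import Relation.Nullary using (¬_)
open import Relation.Binary.PropositionalEquality using (_≡_; _≢_)

record Graph : Set₁ where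
  field
    V   : Set
    Adj : V → V → Set

open Graph public

record Orientation (G : Graph) : Set₁ where
  field
    Arc     : V G → V G → Set
    arc⇒adj : ∀ {u v} → Arc u v → Adj G u v
    adj⇒arc : ∀ {u v} → Adj G u v → Arc u v ⊎ Arc v u
    antisym : ∀ {u v} → Arc u v → Arc v u → ⊥

open Orientation public

module _ {G : Graph} (D : Orientation G) where

  data Walk : V G → V G → ℕ → Set where
    here : ∀ {u} → Walk u u zero
    step : ∀ {u w v n} → Arc D u w → Walk w v n → Walk u v (suc n)

  DistLe : V G → V G → ℕ → Set
  DistLe u v d = ∃[ n ] (n ≤ d × Walk u v n)

  DistEq : V G → V G → ℕ → Set
  DistEq u v d = Walk u v d × (∀ n → n < d → ¬ Walk u v n)

  StronglyConnected : Set
  StronglyConnected = ∀ u v → ∃[ n ] Walk u v n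

  HasDiameter : ℕ → Set
  HasDiameter d = (∀ u v → DistLe u v d) × (∃[ u ] ∃[ v ] DistEq u v d)

OrientedDiameter : Graph → ℕ → Set₁
OrientedDiameter G d =
  (Σ[ D ∈ Orientation G ] (StronglyConnected D × HasDiameter D d))
  × (∀ (D : Orientation G) → StronglyConnected D → ∀ d' → HasDiameter D d' → d ≤ d')

part : ∀ {a b c} → Fin a ⊎ (Fin b ⊎ Fin c) → Fin 3
part (inj₁ _)        = Fin.zero
part (inj₂ (inj₁ _)) = Fin.suc Fin.zero
part (inj₂ (inj₂ _)) = Fin.suc (Fin.suc Fin.zero)

K3 : ℕ → ℕ → ℕ → Graph
K3 a b c = record
  { V   = Fin a ⊎ (Fin b ⊎ Fin c)
  ; Adj = λ u v → part {a} {b} {c} u ≢ part {a} {b} {c} v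
  }

{-# OPTIONS --safe #-}
module Submission where

-- Call the parts A = {a₀, a₁, a₂}, B (of size p) and C, and let k = ⌊p/2⌋. As q − p < C(p, k),
-- B has distinct k-subsets L, E₀, …, E_{q−p−1} with L ∩ E₀ = ∅. Split C into a twin of every
-- y ∈ B, entered from y and leaving to B − y, and a coded vertex for every E_t, leaving to E_t
-- and entered from B − E_t. Orient a₀ → B → a₂ and a₂ → C → a₀, and let a₁ send arcs exactly
-- to L and to the twins. Since the k-sets form an antichain and each misses at least two
-- vertices of B, every ordered pair is then joined by a path of length at most 2, while the
-- non-adjacent a₀, a₁ force diameter at least 2 in every orientation.

open import Defs
open import Data.Nat using (ℕ; zero; suc; _≤_; _<_; _+_; _∸_; _/_; z≤n; s≤s)
open import Data.Nat.Combinatorics using (_C_; nCk+nC[k+1]≡[n+1]C[k+1])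
open import Data.Nat.DivMod using (m/n*n≤m; /-monoˡ-≤)
open import Data.Nat.Properties
  using ( ≤-refl; ≤-reflexive; ≤-trans; <⇒≤; <-irrefl; ≤-pred; ≮⇒≥; n≤1+n; m<m+n; m+n≤o⇒m≤o∸n
        ; +-comm; +-suc; +-identityʳ; *-comm; +-monoˡ-≤; +-cancelʳ-≤; m+[n∸m]≡n; module ≤-Reasoning )
open import Data.Fin using (Fin; zero; suc; _≟_; splitAt; join; _↑ˡ_; _↑ʳ_; punchIn; punchOut; inject≤)
open import Data.Fin.Properties
  using ( suc-injective; splitAt-↑ˡ; splitAt-↑ʳ; join-splitAt
        ; punchIn-injective; punchInᵢ≢i; punchIn-punchOut; inject≤-injective )
open import Data.Fin.Subset
  using (Subset; inside; outside; ⊥; ⁅_⁆; ∁; _∩_; _∈_; _∉_; ∣_∣; Nonempty; Empty)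
open import Data.Fin.Subset.Properties
  using (_∈?_; drop-there; ∣⊥∣≡0; ∣⁅x⁆∣≡1; ∣∁p∣≡n∸∣p∣; x∈∁p⇒x∉p; x∉⁅y⁆⇒x≢y; x∈p∩q⁺)
open import Data.Vec using (_∷_; []; here; there)
open import Data.Vec.Properties using (∷-injectiveˡ; ∷-injectiveʳ)
open import Data.Sum using (_⊎_; inj₁; inj₂; [_,_]′; swap)
open import Data.Product using (_×_; _,_; proj₁; ∃-syntax; ∃₂; Σ-syntax)
open import Data.Empty using () renaming (⊥ to ⊥₀)
open import Data.Unit using (⊤; tt)
open import Function using (_∘_)
open import Function.Definitions using (Injective)
open import Relation.Nullary using (¬_; ¬?; yes; no; contradiction)
open import Relation.Nullary.Decidable using (toSum)
open import Relation.Binary.Definitions using (Decidable)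
open import Relation.Binary.PropositionalEquality

module _ {G : Graph} (D : Orientation G) where

  dist≤2-refl : ∀ {u} → DistLe D u u 2
  dist≤2-refl = 0 , z≤n , here

  dist≤2-arc : ∀ {u v} → Arc D u v → DistLe D u v 2
  dist≤2-arc u→v = 1 , s≤s z≤n , step u→v here

  dist≤2-via : ∀ {u v} w → Arc D u w → Arc D w v → DistLe D u v 2
  dist≤2-via w u→w w→v = 2 , ≤-refl , step {w = w} u→w (step w→v here)

  no-walk<2 : ∀ {u v n} → u ≢ v → ¬ Adj G u v → n < 2 → ¬ Walk D u v n
  no-walk<2 u≢v _    _                 here           = u≢v refl
  no-walk<2 _   ¬adj _                 (step u→v here) = ¬adj (arc⇒adj D u→v)
  no-walk<2 _   _    (s≤s (s≤s ()))    (step _ (step _ _))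

orientedDiameter≡2 : ∀ {G} (D : Orientation G) → (∀ u v → DistLe D u v 2) →
  ∀ {u v} → u ≢ v → ¬ Adj G u v → OrientedDiameter G 2
orientedDiameter≡2 {G} D dist≤2 {u} {v} u≢v ¬adj =
  (D , strong , dist≤2 , u , v , walk₂ (dist≤2 u v) , λ _ n<2 → no-walk<2 D u≢v ¬adj n<2) , minimal
  where
  strong : StronglyConnected D
  strong x y with dist≤2 x y
  ... | n , _ , w = n , w

  walk₂ : DistLe D u v 2 → Walk D u v 2
  walk₂ (2 , _ , w) = w
  walk₂ (0 , _ , w) = contradiction w (no-walk<2 D u≢v ¬adj (s≤s z≤n))
  walk₂ (1 , _ , w) = contradiction w (no-walk<2 D u≢v ¬adj ≤-refl)
  walk₂ (suc (suc (suc _)) , s≤s (s≤s ()) , _)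

  minimal : ∀ (D′ : Orientation G) → StronglyConnected D′ → ∀ d → HasDiameter D′ d → 2 ≤ d
  minimal D′ _ d (dist≤d , _) with dist≤d u v
  ... | n , n≤d , w = ≤-trans (≮⇒≥ λ n<2 → no-walk<2 D′ u≢v ¬adj n<2 w) n≤d

pattern inA x = inj₁ x
pattern inB y = inj₂ (inj₁ y)
pattern inC z = inj₂ (inj₂ z)

TripartiteArc : ∀ {a b c} → (Fin a → Fin b → Set) → (Fin a → Fin c → Set) → (Fin b → Fin c → Set) →
  V (K3 a b c) → V (K3 a b c) → Set
TripartiteArc R S T (inA x) (inB y) = R x y
TripartiteArc R S T (inB y) (inA x) = ¬ R x y
TripartiteArc R S T (inA x) (inC z) = S x z
TripartiteArc R S T (inC z) (inA x) = ¬ S x z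
TripartiteArc R S T (inB y) (inC z) = T y z
TripartiteArc R S T (inC z) (inB y) = ¬ T y z
TripartiteArc R S T _       _       = ⊥₀

tripartite : ∀ {a b c} {R : Fin a → Fin b → Set} {S : Fin a → Fin c → Set} {T : Fin b → Fin c → Set}
  → Decidable R → Decidable S → Decidable T → Orientation (K3 a b c)
tripartite {a} {b} {c} {R} {S} {T} R? S? T? = record
  { Arc     = Arc′
  ; arc⇒adj = arc-between-parts
  ; adj⇒arc = edge-oriented
  ; antisym = λ {u} {v} → no-2-cycle {u} {v}
  }
  where
  Arc′ : V (K3 a b c) → V (K3 a b c) → Set
  Arc′ = TripartiteArc R S T

  arc-between-parts : ∀ {u v} → Arc′ u v → Adj (K3 a b c) u v
  arc-between-parts {inA _} {inB _} _ ()
  arc-between-parts {inA _} {inC _} _ ()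
  arc-between-parts {inB _} {inA _} _ ()
  arc-between-parts {inB _} {inC _} _ ()
  arc-between-parts {inC _} {inA _} _ ()
  arc-between-parts {inC _} {inB _} _ ()

  edge-oriented : ∀ {u v} → Adj (K3 a b c) u v → Arc′ u v ⊎ Arc′ v u
  edge-oriented {inA x} {inB y} _   = toSum (R? x y)
  edge-oriented {inB y} {inA x} _   = swap (toSum (R? x y))
  edge-oriented {inA x} {inC z} _   = toSum (S? x z)
  edge-oriented {inC z} {inA x} _   = swap (toSum (S? x z))
  edge-oriented {inB y} {inC z} _   = toSum (T? y z)
  edge-oriented {inC z} {inB y} _   = swap (toSum (T? y z))
  edge-oriented {inA _} {inA _} adj = contradiction refl adj
  edge-oriented {inB _} {inB _} adj = contradiction refl adj
  edge-oriented {inC _} {inC _} adj = contradiction refl adj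

  no-2-cycle : ∀ {u v} → Arc′ u v → Arc′ v u → ⊥₀
  no-2-cycle {inA _} {inB _} r ¬r = ¬r r
  no-2-cycle {inB _} {inA _} ¬r r = ¬r r
  no-2-cycle {inA _} {inC _} r ¬r = ¬r r
  no-2-cycle {inC _} {inA _} ¬r r = ¬r r
  no-2-cycle {inB _} {inC _} r ¬r = ¬r r
  no-2-cycle {inC _} {inB _} ¬r r = ¬r r

∃x∈p∧x∉q-∷ : ∀ {n s t} {p q : Subset n} → ∃[ x ] (x ∈ p × x ∉ q) → ∃[ x ] (x ∈ s ∷ p × x ∉ t ∷ q)
∃x∈p∧x∉q-∷ (x , x∈p , x∉q) = suc x , there x∈p , x∉q ∘ drop-there

∣q∣≤∣p∣⇒∃x∈p∧x∉q : ∀ {n} (p q : Subset n) → ∣ q ∣ ≤ ∣ p ∣ → p ≢ q → ∃[ x ] (x ∈ p × x ∉ q)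
∣q∣≤∣p∣⇒∃x∈p∧x∉q []            []            _   p≢q = contradiction refl p≢q
∣q∣≤∣p∣⇒∃x∈p∧x∉q (inside  ∷ p) (outside ∷ q) _   _   = zero , here , λ ()
∣q∣≤∣p∣⇒∃x∈p∧x∉q (inside  ∷ p) (inside  ∷ q) q≤p p≢q =
  ∃x∈p∧x∉q-∷ (∣q∣≤∣p∣⇒∃x∈p∧x∉q p q (≤-pred q≤p) (p≢q ∘ cong (inside ∷_)))
∣q∣≤∣p∣⇒∃x∈p∧x∉q (outside ∷ p) (outside ∷ q) q≤p p≢q =
  ∃x∈p∧x∉q-∷ (∣q∣≤∣p∣⇒∃x∈p∧x∉q p q q≤p (p≢q ∘ cong (outside ∷_)))
∣q∣≤∣p∣⇒∃x∈p∧x∉q (outside ∷ p) (inside  ∷ q) q<p _   =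
  ∃x∈p∧x∉q-∷ (∣q∣≤∣p∣⇒∃x∈p∧x∉q p q (<⇒≤ q<p) (λ p≡q → <-irrefl (cong ∣_∣ (sym p≡q)) q<p))

0<∣p∣⇒Nonempty : ∀ {n} (p : Subset n) → 0 < ∣ p ∣ → Nonempty p
0<∣p∣⇒Nonempty {n} p 0<∣p∣ with ∣q∣≤∣p∣⇒∃x∈p∧x∉q p ⊥ (≤-trans (≤-reflexive (∣⊥∣≡0 n)) z≤n) p≢⊥
  where
  p≢⊥ : p ≢ ⊥
  p≢⊥ p≡⊥ = <-irrefl (sym (trans (cong ∣_∣ p≡⊥) (∣⊥∣≡0 n))) 0<∣p∣
... | x , x∈p , _ = x , x∈p

∃x∉p∧x≢y : ∀ {n} (p : Subset n) → 2 + ∣ p ∣ ≤ n → (y : Fin n) → ∃[ x ] (x ∉ p × x ≢ y)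
∃x∉p∧x≢y {n} p 2+∣p∣≤n y with ∣q∣≤∣p∣⇒∃x∈p∧x∉q (∁ p) ⁅ y ⁆ (<⇒≤ 1<∣∁p∣) ∁p≢⁅y⁆
  where
  1<∣∁p∣ : ∣ ⁅ y ⁆ ∣ < ∣ ∁ p ∣
  1<∣∁p∣ = subst₂ _<_ (sym (∣⁅x⁆∣≡1 y)) (sym (∣∁p∣≡n∸∣p∣ p)) (m+n≤o⇒m≤o∸n 2 2+∣p∣≤n)
  ∁p≢⁅y⁆ : ∁ p ≢ ⁅ y ⁆
  ∁p≢⁅y⁆ ∁p≡⁅y⁆ = <-irrefl (cong ∣_∣ (sym ∁p≡⁅y⁆)) 1<∣∁p∣
... | x , x∈∁p , x∉⁅y⁆ = x , x∈∁p⇒x∉p x∈∁p , x∉⁅y⁆⇒x≢y x∉⁅y⁆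

-- n C k is defined through factorials, so Fin (n C k) cannot be split along Pascal's rule.
choose : ℕ → ℕ → ℕ
choose n       zero    = 1
choose zero    (suc k) = 0
choose (suc n) (suc k) = choose n k + choose n (suc k)

choose≡C : ∀ n k → choose n k ≡ n C k
choose≡C n       zero    = refl
choose≡C zero    (suc k) = refl
choose≡C (suc n) (suc k) =
  trans (cong₂ _+_ (choose≡C n k) (choose≡C n (suc k))) (nCk+nC[k+1]≡[n+1]C[k+1] n k)

kSubset : ∀ n k → Fin (choose n k) → Subset n
kSubset n       zero    _ = ⊥
kSubset (suc n) (suc k) i =
  [ (inside ∷_) ∘ kSubset n k , (outside ∷_) ∘ kSubset n (suc k) ]′ (splitAt (choose n k) i)

kSubset-↑ˡ : ∀ n k i → kSubset (suc n) (suc k) (i ↑ˡ choose n (suc k)) ≡ inside ∷ kSubset n k i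
kSubset-↑ˡ n k i rewrite splitAt-↑ˡ (choose n k) i (choose n (suc k)) = refl

kSubset-↑ʳ : ∀ n k i → kSubset (suc n) (suc k) (choose n k ↑ʳ i) ≡ outside ∷ kSubset n (suc k) i
kSubset-↑ʳ n k i rewrite splitAt-↑ʳ (choose n k) (choose n (suc k)) i = refl

∣kSubset∣≡k : ∀ n k i → ∣ kSubset n k i ∣ ≡ k
∣kSubset∣≡k n       zero    _ = ∣⊥∣≡0 n
∣kSubset∣≡k (suc n) (suc k) i with splitAt (choose n k) i
... | inj₁ i′ = cong suc (∣kSubset∣≡k n k i′)
... | inj₂ i′ = ∣kSubset∣≡k n (suc k) i′

splitAt-injective : ∀ m {n} → Injective _≡_ _≡_ (splitAt m {n})
splitAt-injective m {n} {i} {j} eq = begin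
  i                       ≡⟨ join-splitAt m n i ⟨
  join m n (splitAt m i)  ≡⟨ cong (join m n) eq ⟩
  join m n (splitAt m j)  ≡⟨ join-splitAt m n j ⟩
  j                       ∎
  where open ≡-Reasoning

kSubset-injective : ∀ n k → Injective _≡_ _≡_ (kSubset n k)
kSubset-injective n       zero    {zero} {zero} _ = refl
kSubset-injective (suc n) (suc k) {i} {j} eq
  with splitAt (choose n k) i in i↦ | splitAt (choose n k) j in j↦
... | inj₁ i′ | inj₁ j′ = splitAt-injective (choose n k)
  (trans i↦ (trans (cong inj₁ (kSubset-injective n k (∷-injectiveʳ eq))) (sym j↦)))
... | inj₂ i′ | inj₂ j′ = splitAt-injective (choose n k)
  (trans i↦ (trans (cong inj₂ (kSubset-injective n (suc k) (∷-injectiveʳ eq))) (sym j↦)))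
... | inj₁ _  | inj₂ _ with () ← ∷-injectiveˡ eq
... | inj₂ _  | inj₁ _ with () ← ∷-injectiveˡ eq

Empty-outside∷ : ∀ {n} {p : Subset n} → Empty p → Empty (outside ∷ p)
Empty-outside∷ p=∅ (suc x , there x∈p) = p=∅ (x , x∈p)

disjoint-kSubsets : ∀ n a b → a + b ≤ n → ∃₂ λ i j → Empty (kSubset n a i ∩ kSubset n b j)
disjoint-kSubsets zero    zero    zero    _ = zero , zero , λ ()
disjoint-kSubsets (suc n) zero    zero    _ with disjoint-kSubsets n zero zero z≤n
... | i , j , X∩Y=∅ = i , j , Empty-outside∷ X∩Y=∅
disjoint-kSubsets (suc n) zero    (suc b) (s≤s b≤n) with disjoint-kSubsets n zero b b≤n
... | i , j , X∩Y=∅ = i , j ↑ˡ _ ,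
  subst (λ Y → Empty (⊥ ∩ Y)) (sym (kSubset-↑ˡ n b j)) (Empty-outside∷ X∩Y=∅)
disjoint-kSubsets (suc n) (suc a) zero    (s≤s a≤n) with disjoint-kSubsets n a zero a≤n
... | i , j , X∩Y=∅ = i ↑ˡ _ , j ,
  subst (λ X → Empty (X ∩ ⊥)) (sym (kSubset-↑ˡ n a i)) (Empty-outside∷ X∩Y=∅)
disjoint-kSubsets (suc n) (suc a) (suc b) (s≤s a+b≤n) with disjoint-kSubsets n a (suc b) a+b≤n
... | i , j , X∩Y=∅ = i ↑ˡ _ , choose n b ↑ʳ j ,
  subst₂ (λ X Y → Empty (X ∩ Y)) (sym (kSubset-↑ˡ n a i)) (sym (kSubset-↑ʳ n b j))
    (Empty-outside∷ X∩Y=∅)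

_◃_ : ∀ {m n} → Fin (suc n) → (Fin m → Fin n) → Fin (suc m) → Fin (suc n)
(i ◃ f) zero    = i
(i ◃ f) (suc t) = punchIn i (f t)

◃-injective : ∀ {m n} (i : Fin (suc n)) {f : Fin m → Fin n} →
  Injective _≡_ _≡_ f → Injective _≡_ _≡_ (i ◃ f)
◃-injective i f-inj {zero}  {zero}  _  = refl
◃-injective i f-inj {zero}  {suc u} eq = contradiction (sym eq) (punchInᵢ≢i i _)
◃-injective i f-inj {suc t} {zero}  eq = contradiction eq (punchInᵢ≢i i _)
◃-injective i f-inj {suc t} {suc u} eq = cong suc (f-inj (punchIn-injective i _ _ eq))

injection-0↦i-1↦j : ∀ {m n} → 2 + m ≤ n → (i j : Fin n) → i ≢ j →
  Σ[ ι ∈ (Fin (2 + m) → Fin n) ] (Injective _≡_ _≡_ ι × ι zero ≡ i × ι (suc zero) ≡ j)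
injection-0↦i-1↦j {n = suc (suc _)} (s≤s (s≤s m≤n)) i j i≢j =
  i ◃ (punchOut i≢j ◃ λ t → inject≤ t m≤n) ,
  ◃-injective i (◃-injective (punchOut i≢j) (λ {t} {u} → inject≤-injective m≤n m≤n t u)) ,
  refl ,
  punchIn-punchOut i≢j

record UniformFamily (n k m : ℕ) : Set where
  field
    member             : Fin (2 + m) → Subset n
    member-injective   : Injective _≡_ _≡_ member
    ∣member∣≡k         : ∀ i → ∣ member i ∣ ≡ k
    first-two-disjoint : Empty (member zero ∩ member (suc zero))

uniformFamily : ∀ {n k m} → 1 ≤ k → k + k ≤ n → 2 + m ≤ choose n k → UniformFamily n k m
uniformFamily {n} {k} 1≤k 2k≤n 2+m≤C with disjoint-kSubsets n k k 2k≤n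
... | i , j , X∩Y=∅ with injection-0↦i-1↦j 2+m≤C i j i≢j
  where
  i≢j : i ≢ j
  i≢j refl with 0<∣p∣⇒Nonempty (kSubset n k i) (subst (0 <_) (sym (∣kSubset∣≡k n k i)) 1≤k)
  ... | x , x∈X = X∩Y=∅ (x , x∈p∩q⁺ (x∈X , x∈X))
... | ι , ι-injective , ι0≡i , ι1≡j = record
  { member             = kSubset n k ∘ ι
  ; member-injective   = ι-injective ∘ kSubset-injective n k
  ; ∣member∣≡k         = ∣kSubset∣≡k n k ∘ ι
  ; first-two-disjoint =
      subst₂ (λ a b → Empty (kSubset n k a ∩ kSubset n k b)) (sym ι0≡i) (sym ι1≡j) X∩Y=∅
  }

pattern a₀ = zero
pattern a₁ = suc zero
pattern a₂ = suc (suc zero)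

module DiameterTwo {p k m : ℕ} (1≤k : 1 ≤ k) (2+k≤p : 2 + k ≤ p) (𝓕 : UniformFamily p k m) where

  open UniformFamily 𝓕

  L : Subset p
  L = member zero

  E : Fin (suc m) → Subset p
  E t = member (suc t)

  member-⊈ : ∀ {i j} → i ≢ j → ∃[ x ] (x ∈ member i × x ∉ member j)
  member-⊈ {i} {j} i≢j = ∣q∣≤∣p∣⇒∃x∈p∧x∉q (member i) (member j)
    (≤-reflexive (trans (∣member∣≡k j) (sym (∣member∣≡k i)))) (i≢j ∘ member-injective)

  member-nonempty : ∀ i → Nonempty (member i)
  member-nonempty i = 0<∣p∣⇒Nonempty (member i) (subst (0 <_) (sym (∣member∣≡k i)) 1≤k)

  ∃x∉member∧x≢y : ∀ i y → ∃[ x ] (x ∉ member i × x ≢ y)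
  ∃x∉member∧x≢y i = ∃x∉p∧x≢y (member i) (subst (λ s → 2 + s ≤ p) (sym (∣member∣≡k i)) 2+k≤p)

  L∩E₀=∅ : ∀ {x} → x ∈ L → x ∉ E zero
  L∩E₀=∅ {x} x∈L x∈E₀ = first-two-disjoint (x , x∈p∩q⁺ (x∈L , x∈E₀))

  y₀ : Fin p
  y₀ = proj₁ (member-nonempty zero)

  ∃x≢y : ∀ y → ∃[ x ] (x ≢ y)
  ∃x≢y y with ∃x∉member∧x≢y zero y
  ... | x , _ , x≢y = x , x≢y

  Kind : Set
  Kind = Fin p ⊎ Fin (suc m)

  pattern twin x  = inj₁ x
  pattern coded t = inj₂ t

  kind : Fin (p + suc m) → Kind
  kind = splitAt p

  _A→B_ : Fin 3 → Fin p → Set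
  a₀ A→B _ = ⊤
  a₁ A→B y = y ∈ L
  a₂ A→B _ = ⊥₀

  _A→C_ : Fin 3 → Kind → Set
  a₀ A→C _       = ⊥₀
  a₁ A→C twin _  = ⊤
  a₁ A→C coded _ = ⊥₀
  a₂ A→C _       = ⊤

  _B→C_ : Fin p → Kind → Set
  y B→C twin x  = y ≡ x
  y B→C coded t = y ∉ E t

  _A→B?_ : Decidable _A→B_
  a₀ A→B? _ = yes tt
  a₁ A→B? y = y ∈? L
  a₂ A→B? _ = no λ ()

  _A→C?_ : Decidable _A→C_
  a₀ A→C? _       = no λ ()
  a₁ A→C? twin _  = yes tt
  a₁ A→C? coded _ = no λ ()
  a₂ A→C? _       = yes tt

  _B→C?_ : Decidable _B→C_
  y B→C? twin x  = y ≟ x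
  y B→C? coded t = ¬? (y ∈? E t)

  O : Orientation (K3 3 p (p + suc m))
  O = tripartite {R = _A→B_} _A→B?_ (λ a c → a A→C? kind c) (λ y c → y B→C? kind c)

  _⇝_ : V (K3 3 p (p + suc m)) → V (K3 3 p (p + suc m)) → Set
  u ⇝ v = DistLe O u v 2

  twinVertex : Fin p → V (K3 3 p (p + suc m))
  twinVertex x = inC (x ↑ˡ suc m)

  kind-twin : ∀ x → kind (x ↑ˡ suc m) ≡ twin x
  kind-twin x = splitAt-↑ˡ p x (suc m)

  codedVertex : Fin (suc m) → V (K3 3 p (p + suc m))
  codedVertex t = inC (p ↑ʳ t)

  kind-coded : ∀ t → kind (p ↑ʳ t) ≡ coded t
  kind-coded t = splitAt-↑ʳ p (suc m) t

  same-kind⇒≡ : ∀ {c c′ κ} → kind c ≡ κ → kind c′ ≡ κ → c ≡ c′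
  same-kind⇒≡ c∶κ c′∶κ = splitAt-injective p (trans c∶κ (sym c′∶κ))

  -- At inC c, Arc O unfolds to a relation on kind c, which with kind c cannot rewrite;
  -- these transport arcs along kind c ≡ κ instead.
  A⟶C : ∀ a {c κ} → kind c ≡ κ → a A→C κ → Arc O (inA a) (inC c)
  A⟶C _ refl a→c = a→c

  C⟶A : ∀ a {c κ} → kind c ≡ κ → ¬ a A→C κ → Arc O (inC c) (inA a)
  C⟶A _ refl c→a = c→a

  B⟶C : ∀ {y c κ} → kind c ≡ κ → y B→C κ → Arc O (inB y) (inC c)
  B⟶C refl y→c = y→c

  C⟶B : ∀ {y c κ} → kind c ≡ κ → ¬ y B→C κ → Arc O (inC c) (inB y)
  C⟶B refl c→y = c→y

  A⇝A : ∀ a a′ → inA a ⇝ inA a′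
  A⇝A a₀ a₀ = dist≤2-refl O
  A⇝A a₁ a₁ = dist≤2-refl O
  A⇝A a₂ a₂ = dist≤2-refl O
  A⇝A a₀ a₁ with ∃x∉member∧x≢y zero y₀
  ... | y , y∉L , _ = dist≤2-via O (inB y) tt y∉L
  A⇝A a₀ a₂ = dist≤2-via O (inB y₀) tt λ ()
  A⇝A a₁ a₀ =
    dist≤2-via O (twinVertex y₀) (A⟶C a₁ (kind-twin y₀) tt) (C⟶A a₀ (kind-twin y₀) λ ())
  A⇝A a₁ a₂ with member-nonempty zero
  ... | y , y∈L = dist≤2-via O (inB y) y∈L λ ()
  A⇝A a₂ a₀ =
    dist≤2-via O (twinVertex y₀) (A⟶C a₂ (kind-twin y₀) tt) (C⟶A a₀ (kind-twin y₀) λ ())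
  A⇝A a₂ a₁ =
    dist≤2-via O (codedVertex zero) (A⟶C a₂ (kind-coded zero) tt) (C⟶A a₁ (kind-coded zero) λ ())

  A⇝B : ∀ a y → inA a ⇝ inB y
  A⇝B a₀ y = dist≤2-arc O tt
  A⇝B a₁ y with ∃x≢y y
  ... | x , x≢y =
    dist≤2-via O (twinVertex x) (A⟶C a₁ (kind-twin x) tt) (C⟶B (kind-twin x) (x≢y ∘ sym))
  A⇝B a₂ y with ∃x≢y y
  ... | x , x≢y =
    dist≤2-via O (twinVertex x) (A⟶C a₂ (kind-twin x) tt) (C⟶B (kind-twin x) (x≢y ∘ sym))

  B⇝A : ∀ y a → inB y ⇝ inA a
  B⇝A y a₀ =
    dist≤2-via O (twinVertex y) (B⟶C (kind-twin y) refl) (C⟶A a₀ (kind-twin y) λ ())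
  B⇝A y a₁ with y ∈? L
  ... | no  y∉L = dist≤2-arc O y∉L
  ... | yes y∈L =
    dist≤2-via O (codedVertex zero)
      (B⟶C (kind-coded zero) (L∩E₀=∅ y∈L)) (C⟶A a₁ (kind-coded zero) λ ())
  B⇝A y a₂ = dist≤2-arc O λ ()

  B⇝B : ∀ y y′ → inB y ⇝ inB y′
  B⇝B y y′ with y ≟ y′
  ... | yes refl = dist≤2-refl O
  ... | no  y≢y′ =
    dist≤2-via O (twinVertex y) (B⟶C (kind-twin y) refl) (C⟶B (kind-twin y) (y≢y′ ∘ sym))

  A⇝C : ∀ a c → inA a ⇝ inC c
  A⇝C a c with kind c in c∶κ
  A⇝C a₀ c | twin x = dist≤2-via O (inB x) tt (B⟶C c∶κ refl)
  A⇝C a₁ c | twin x = dist≤2-arc O (A⟶C a₁ c∶κ tt)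
  A⇝C a₂ c | twin x = dist≤2-arc O (A⟶C a₂ c∶κ tt)
  A⇝C a c | coded t with member-⊈ {zero} {suc t} (λ ())
  A⇝C a₀ c | coded t | y , _   , y∉E = dist≤2-via O (inB y) tt (B⟶C c∶κ y∉E)
  A⇝C a₁ c | coded t | y , y∈L , y∉E = dist≤2-via O (inB y) y∈L (B⟶C c∶κ y∉E)
  A⇝C a₂ c | coded t | _ = dist≤2-arc O (A⟶C a₂ c∶κ tt)

  C⇝A : ∀ c a → inC c ⇝ inA a
  C⇝A c a with kind c in c∶κ
  C⇝A c a₀ | twin x = dist≤2-arc O (C⟶A a₀ c∶κ λ ())
  C⇝A c a₁ | twin x with ∃x∉member∧x≢y zero x
  ... | y , y∉L , y≢x = dist≤2-via O (inB y) (C⟶B c∶κ y≢x) y∉L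
  C⇝A c a₂ | twin x with ∃x≢y x
  ... | y , y≢x = dist≤2-via O (inB y) (C⟶B c∶κ y≢x) λ ()
  C⇝A c a₀ | coded t = dist≤2-arc O (C⟶A a₀ c∶κ λ ())
  C⇝A c a₁ | coded t = dist≤2-arc O (C⟶A a₁ c∶κ λ ())
  C⇝A c a₂ | coded t with member-nonempty (suc t)
  ... | y , y∈E = dist≤2-via O (inB y) (C⟶B c∶κ λ y∉E → y∉E y∈E) λ ()

  B⇝C : ∀ y c → inB y ⇝ inC c
  B⇝C y c with y B→C? kind c
  ... | yes y→c = dist≤2-arc O y→c
  ... | no  _   = dist≤2-via O (inA a₂) (λ ()) tt

  C⇝B : ∀ c y → inC c ⇝ inB y
  C⇝B c y with y B→C? kind c
  ... | no  c→y = dist≤2-arc O c→y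
  ... | yes _   = dist≤2-via O (inA a₀) (λ ()) tt

  C⇝C : ∀ c c′ → inC c ⇝ inC c′
  C⇝C c c′ with c ≟ c′
  ... | yes refl = dist≤2-refl O
  ... | no c≢c′ with kind c in c∶κ | kind c′ in c′∶κ′
  ...   | twin x  | twin x′ =
    dist≤2-via O (inB x′) (C⟶B c∶κ (x≢x′ ∘ sym)) (B⟶C c′∶κ′ refl)
    where
    x≢x′ : x ≢ x′
    x≢x′ x≡x′ = c≢c′ (same-kind⇒≡ c∶κ (trans c′∶κ′ (cong twin (sym x≡x′))))
  ...   | twin x  | coded t with ∃x∉member∧x≢y (suc t) x
  ...     | y , y∉E , y≢x = dist≤2-via O (inB y) (C⟶B c∶κ y≢x) (B⟶C c′∶κ′ y∉E)
  C⇝C c c′ | no _ | coded t | twin x =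
    dist≤2-via O (inA a₁) (C⟶A a₁ c∶κ λ ()) (A⟶C a₁ c′∶κ′ tt)
  C⇝C c c′ | no c≢c′ | coded t | coded s with member-⊈ {suc t} {suc s} (t≢s ∘ suc-injective)
    where
    t≢s : t ≢ s
    t≢s t≡s = c≢c′ (same-kind⇒≡ c∶κ (trans c′∶κ′ (cong coded (sym t≡s))))
  ... | y , y∈Eₜ , y∉Eₛ =
    dist≤2-via O (inB y) (C⟶B c∶κ λ y∉Eₜ → y∉Eₜ y∈Eₜ) (B⟶C c′∶κ′ y∉Eₛ)

  dist≤2 : ∀ u v → u ⇝ v
  dist≤2 (inA a) (inA a′) = A⇝A a a′
  dist≤2 (inA a) (inB y)  = A⇝B a y
  dist≤2 (inA a) (inC c)  = A⇝C a c
  dist≤2 (inB y) (inA a)  = B⇝A y a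
  dist≤2 (inB y) (inB y′) = B⇝B y y′
  dist≤2 (inB y) (inC c)  = B⇝C y c
  dist≤2 (inC c) (inA a)  = C⇝A c a
  dist≤2 (inC c) (inB y)  = C⇝B c y
  dist≤2 (inC c) (inC c′) = C⇝C c c′

  orientedDiameter : OrientedDiameter (K3 3 p (p + suc m)) 2
  orientedDiameter = orientedDiameter≡2 O dist≤2 {inA a₀} {inA a₁} (λ ()) λ a₀≁a₁ → a₀≁a₁ refl

n/2+n/2≤n : ∀ n → n / 2 + n / 2 ≤ n
n/2+n/2≤n n =
  subst (_≤ n) (trans (*-comm (n / 2) 2) (cong (n / 2 +_) (+-identityʳ (n / 2)))) (m/n*n≤m n 2)

theorem5p8 : ∀ (p q : ℕ) → 5 ≤ p → p + 3 ≤ q → q ≤ 3 + (p C (p / 2)) →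
    OrientedDiameter (K3 3 p q) 2
theorem5p8 p q 5≤p p+3≤q q≤3+C =
  subst (λ r → OrientedDiameter (K3 3 p r) 2) p+[1+m]≡q
    (DiameterTwo.orientedDiameter 1≤k 2+k≤p (uniformFamily 1≤k (n/2+n/2≤n p) 2+m≤choose))
  where
  k : ℕ
  k = p / 2

  m : ℕ
  m = q ∸ suc p

  2≤k : 2 ≤ k
  2≤k = /-monoˡ-≤ 2 5≤p

  1≤k : 1 ≤ k
  1≤k = ≤-trans (s≤s z≤n) 2≤k

  2+k≤p : 2 + k ≤ p
  2+k≤p = ≤-trans (+-monoˡ-≤ k 2≤k) (n/2+n/2≤n p)

  p+[1+m]≡q : p + suc m ≡ q
  p+[1+m]≡q = trans (+-suc p m) (m+[n∸m]≡n (≤-trans (m<m+n p (s≤s z≤n)) p+3≤q))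

  2+m≤choose : 2 + m ≤ choose p k
  2+m≤choose = +-cancelʳ-≤ p (2 + m) (choose p k) (begin
    2 + m + p      ≡⟨ cong suc (trans (+-comm (suc m) p) p+[1+m]≡q) ⟩
    suc q          ≤⟨ s≤s q≤3+C ⟩
    4 + p C k      ≤⟨ +-monoˡ-≤ (p C k) (≤-trans (n≤1+n 4) 5≤p) ⟩
    p + p C k      ≡⟨ +-comm p (p C k) ⟩
    p C k + p      ≡⟨ cong (_+ p) (choose≡C p k) ⟨
    choose p k + p ∎)
    where open ≤-Reasoning
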